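{- Let $0\to M\to N\to P\to0$ be an exact sequence in $\operatorname{Mod}^{\mathrm{BK}}_k$ with $N$ strongly divisible. Then the induced map $M_k\to N_k$ is strict.
   Context: $k$ finite field of characteristic $p$; $\mathfrak{S}=W(k)[[u]]$ with $\varphi(\sum a_iu^i)=\sum\varphi(a_i)u^{ip}$. $\operatorname{Mod}^{\mathrm{BK}}_k$: finite free $k[[u]]$-modules $X$ with a $\varphi$-semilinear $\varphi_X\colon X\to X[1/u]$ whose linearisation becomes an isomorphism after inverting $u$; morphisms are $\varphi$-compatible $k[[u]]$-linear maps; exactness means exactness as modules. $X^\varphi\subset X[1/u]$ is the $k[[u]]$-submodule generated by $\varphi_X(X)$, filtered by $F^iX^\varphi=X^\varphi\cap u^iX$; $F^iX=\{x\in X:\varphi_X(x)\in u^iX\}$; $X_k=X/uX$, $X^\varphi_k=X^\varphi/uX^\varphi$ with quotient filtrations. $\operatorname{Weight}(X)$ is the multiset containing each integer $i$ with multiplicity $\dim_k F^iX^\varphi_k/F^{i+1}X^\varphi_k$. $X$ is strongly divisible if the $k$-semilinear bijection $X_k\to X^\varphi_k$ induced by $\varphi_X$ maps $F^iX_k$ onto $F^iX^\varphi_k$ for all $i$, and $\operatorname{Weight}(X)\subset[0,p]$. A filtration-compatible map $h\colon Y\to Z$ is strict if $h(F^iY)=F^iZ\cap h(Y)$ for all $i$. -}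

module Defs where

open import Level using (_⊔_)
open import Algebra.Bundles using (CommutativeRing)
open import Data.Nat as ℕ using (ℕ; zero; suc; _∸_; pred)
open import Data.Nat.DivMod using (_%_; _/_)
open import Data.Nat.Primality using (Prime)
open import Data.Integer as ℤ using (ℤ; +_; -[1+_])
open import Data.Fin as Fin using (Fin; zero; suc)
open import Data.Product using (∃; ∃₂; _×_; _,_)
open import Data.Sum using (_⊎_)
open import Relation.Nullary using (¬_; yes; no)

-- Everything is relative to a commutative ring K (intended: the finite
-- field k) and a natural number p (intended: its characteristic).
module BK {c ℓ} (K : CommutativeRing c ℓ) (p : ℕ) where
  open CommutativeRing K using (_≈_; _+_; _*_; 0#; 1#) renaming (Carrier to k)

  ntimes : ℕ → k → k
  ntimes zero x = 0#
  ntimes (suc n) x = x + ntimes n x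

  pow : k → ℕ → k
  pow x zero = 1#
  pow x (suc n) = x * pow x n

  record IsFiniteFieldOfChar : Set (c ⊔ ℓ) where
    field
      prime     : Prime p
      one≉zero  : ¬ (1# ≈ 0#)
      inverse   : ∀ x → ¬ (x ≈ 0#) → ∃ λ y → x * y ≈ 1#
      size      : ℕ
      enum      : Fin size → k
      enum-onto : ∀ x → ∃ λ i → enum i ≈ x
      char      : ntimes p 1# ≈ 0#

  -- k[[u]] : power series  f = Σ f(n) uⁿ, equality coefficientwise
  S : Set c
  S = ℕ → k

  _≈S_ : S → S → Set ℓ
  f ≈S g = ∀ n → f n ≈ g n

  0S 1S : S
  0S n = 0#
  1S zero = 1#
  1S (suc n) = 0#

  _+S_ : S → S → S
  (f +S g) n = f n + g n

  Σ≤ : ℕ → (ℕ → k) → k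
  Σ≤ zero h = h 0
  Σ≤ (suc n) h = Σ≤ n h + h (suc n)

  _*S_ : S → S → S
  (f *S g) n = Σ≤ n (λ i → f i * g (n ∸ i))

  -- multiplication by u^m
  sh : ℕ → S → S
  sh m f n with n ℕ.<? m
  ... | yes _ = 0#
  ... | no _  = f (n ∸ m)

  -- φ on k[[u]] (reduction mod p of φ on 𝔖): Σ aᵢuⁱ ↦ Σ aᵢᵖ u^{ip}
  frobS : S → S
  frobS f n with n % suc (pred p) ℕ.≟ 0
  ... | yes _ = pow (f (n / suc (pred p))) p
  ... | no _  = 0#

  V : ℕ → Set c
  V n = Fin n → S

  _≈V_ : ∀ {n} → V n → V n → Set ℓ
  x ≈V y = ∀ i → x i ≈S y i

  0V : ∀ {n} → V n
  0V i = 0S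

  _+V_ : ∀ {n} → V n → V n → V n
  (x +V y) i = x i +S y i

  shV : ∀ {n} → ℕ → V n → V n
  shV m x i = sh m (x i)

  frobV : ∀ {n} → V n → V n
  frobV x i = frobS (x i)

  ΣFin : ∀ n → (Fin n → S) → S
  ΣFin zero h = 0S
  ΣFin (suc n) h = h zero +S ΣFin n (λ j → h (suc j))

  Mat : ℕ → ℕ → Set c
  Mat m n = Fin m → Fin n → S

  app : ∀ {m n} → Mat m n → V n → V m
  app {n = n} A x i = ΣFin n (λ j → A i j *S x j)

  _·M_ : ∀ {m n r} → Mat m n → Mat n r → Mat m r
  (_·M_ {n = n} A B) i j = ΣFin n (λ l → A i l *S B l j)

  _≈M_ : ∀ {m n} → Mat m n → Mat m n → Set ℓ
  A ≈M B = ∀ i j → A i j ≈S B i j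

  uId : ∀ {n} → ℕ → Mat n n
  uId e i j with i Fin.≟ j
  ... | yes _ = sh e 1S
  ... | no _  = 0S

  -- X[1/u]: a pair (m , v) stands for u^{-m} v
  L : ℕ → Set c
  L n = ℕ × V n

  _~_ : ∀ {n} → L n → L n → Set ℓ
  (m , v) ~ (m′ , v′) = shV m′ v ≈V shV m v′

  uPow : ∀ {n} → ℤ → V n → L n
  uPow (+ j) w = 0 , shV j w
  uPow -[1+ j ] w = suc j , w

  InUX : ∀ {n} → ℤ → L n → Set (c ⊔ ℓ)
  InUX i l = ∃ λ w → l ~ uPow i w

  -- Objects of Mod^BK_k, in a chosen basis: X = k[[u]]^rank and
  -- φ_X(x) = u^{-den} · mat · φ(x)   (φ applied coordinatewise).
  record Obj : Set (c ⊔ ℓ) where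
    field
      rank : ℕ
      den  : ℕ
      mat  : Mat rank rank
      -- linearisation u^{-den}·mat is invertible after inverting u
      linIso : ∃₂ λ (B : Mat rank rank) (e : ℕ) →
                 ((mat ·M B) ≈M uId e) × ((B ·M mat) ≈M uId e)

  module _ (X : Obj) where
    open Obj X

    φX : V rank → L rank
    φX x = den , app mat (frobV x)

    -- X^φ ⊆ X[1/u]: submodule generated by φ_X(X), i.e. spanned by the
    -- φ_X(e_j); ι y = Σ y_j φ_X(e_j)
    ι : V rank → L rank
    ι y = den , app mat y

    -- x ≡ x' mod u  (equality in X_k = X/uX, resp. X^φ_k in ι-coordinates)
    _≡u_ : V rank → V rank → Set (c ⊔ ℓ)
    x ≡u x′ = ∃ λ t → x ≈V (x′ +V shV 1 t)

    -- F^i X_k  (image of F^i X = {x : φ_X(x) ∈ u^i X}), class of x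
    FilXk : ℤ → V rank → Set (c ⊔ ℓ)
    FilXk i x = ∃ λ t → InUX i (φX (x +V shV 1 t))

    -- F^i X^φ_k (image of F^i X^φ = X^φ ∩ u^i X), class of ι y
    FilXφk : ℤ → V rank → Set (c ⊔ ℓ)
    FilXφk i y = ∃ λ t → InUX i (ι (y +V shV 1 t))

    -- strongly divisible: the map X_k → X^φ_k, [x] ↦ [φ_X x] = [ι (φ x)],
    -- maps F^i X_k onto F^i X^φ_k, and Weight(X) ⊆ [0,p], i.e. for i ∉ [0,p]
    -- the multiplicity dim F^i/F^{i+1} of i vanishes (F^i ⊆ F^{i+1}).
    record StronglyDivisible : Set (c ⊔ ℓ) where
      field
        into : ∀ i x → FilXk i x → FilXφk i (frobV x)
        onto : ∀ i y → FilXφk i y → ∃ λ x → FilXk i x × (frobV x ≡u y)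
        weight : ∀ i → (i ℤ.< + 0 ⊎ + p ℤ.< i) →
                 ∀ y → FilXφk i y → FilXφk (ℤ.suc i) y

  record Hom (X Y : Obj) : Set (c ⊔ ℓ) where
    field
      hmat : Mat (Obj.rank Y) (Obj.rank X)
      comm : ∀ x → φX Y (app hmat x) ~ (Obj.den X , app hmat (app (Obj.mat X) (frobV x)))

  apply : ∀ {X Y} → Hom X Y → V (Obj.rank X) → V (Obj.rank Y)
  apply f = app (Hom.hmat f)

  record ShortExact {M N P : Obj} (f : Hom M N) (g : Hom N P) : Set (c ⊔ ℓ) where
    field
      f-inj  : ∀ x → apply f x ≈V 0V → x ≈V 0V
      g-surj : ∀ z → ∃ λ y → apply g y ≈V z
      gf≈0   : ∀ x → apply g (apply f x) ≈V 0V
      ker⊆im : ∀ y → apply g y ≈V 0V → ∃ λ x → apply f x ≈V y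

  -- the induced map h : M_k → N_k, [x] ↦ [f x], is strict:
  -- h(F^i M_k) = F^i N_k ∩ h(M_k) for all i
  StrictReduction : ∀ {M N} → Hom M N → Set (c ⊔ ℓ)
  StrictReduction {M} {N} f = ∀ i →
      (∀ x → FilXk M i x → FilXk N i (apply f x))
    × (∀ x → FilXk N i (apply f x) →
         ∃ λ x′ → FilXk M i x′ × _≡u_ N (apply f x′) (apply f x))

module Submission where

open import Defs
open import Algebra.Bundles using (CommutativeRing)
open import Data.Nat as ℕ using (ℕ; zero; suc; _∸_; _≤_; _<_; z≤n; s≤s)
import Data.Nat.Properties as ℕP
open import Data.Nat.Combinatorics using (_C_; nCk+nC[k+1]≡[n+1]C[k+1]; nCn≡1)
open import Data.Nat.Divisibility using (_∣_; divides; ∣⇒≤)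
open import Data.Nat.DivMod using (_%_; _/_; m<n⇒m%n≡m; [m+n]%n≡m%n; m/n≡1+[m∸n]/n)
open import Data.Nat.Primality using (Prime; euclidsLemma; ¬prime[0])
open import Data.Integer as ℤ using (ℤ; +_; -[1+_])
open import Data.Fin as Fin using (Fin; zero; suc; toℕ)
import Data.Fin.Properties as FinP
open import Data.Product using (∃; _×_; _,_; proj₁; proj₂)
open import Data.Sum using (inj₁; inj₂)
open import Data.Empty using (⊥-elim)
open import Relation.Nullary using (yes; no; Dec)
open import Relation.Binary.Bundles using (Setoid)
open import Relation.Binary.PropositionalEquality as ≡ using (_≡_; _≢_)
import Relation.Binary.Reasoning.Setoid as SetoidReasoning

-- One half of strictness holds for every morphism f: as f commutes with φ,
-- it maps F^i M_k into F^i N_k.  For the other half let f(x) ∈ F^i N_k.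
--  * i ≤ p: then x ∈ F^i M_k.  Strong divisibility forces φ_N(N) ⊆ N (all
--    weights are ≥ 0), so from φ_N(f x + u t) = φ_N(f x) + uᵖ φ_N(t) we get
--    f(φ_M x) = φ_N(f x) ∈ uⁱN; as P has no u-torsion, φ_M(x) ∈ uⁱM.
--  * i > p: then F^i N_k = 0 (all weights are ≤ p, and k is reduced), so
--    f(x) ≡ f(0) mod u, and 0 ∈ F^i M_k.

absorption : ∀ n k → suc k ℕ.* (suc n C suc k) ≡ suc n ℕ.* (n C k)
absorption zero    zero    = ≡.refl
absorption zero    (suc k) = ℕP.*-zeroʳ (suc (suc k))
absorption (suc n) zero    = begin
    1 ℕ.* (suc (suc n) C 1)
      ≡⟨ ℕP.*-identityˡ _ ⟩
    suc (suc n) C 1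
      ≡⟨ ≡.sym (nCk+nC[k+1]≡[n+1]C[k+1] (suc n) 0) ⟩
    1 ℕ.+ suc n C 1
      ≡⟨ ≡.cong (1 ℕ.+_) (≡.trans (≡.sym (ℕP.*-identityˡ _)) (absorption n 0)) ⟩
    suc (suc n) ℕ.* (suc n C 0) ∎
  where open ≡.≡-Reasoning
absorption (suc n) (suc k) = begin
    suc (suc k) ℕ.* (suc (suc n) C suc (suc k))
      ≡⟨ ≡.cong (suc (suc k) ℕ.*_) (≡.sym (nCk+nC[k+1]≡[n+1]C[k+1] (suc n) (suc k))) ⟩
    suc (suc k) ℕ.* (suc n C suc k ℕ.+ suc n C suc (suc k))
      ≡⟨ ℕP.*-distribˡ-+ (suc (suc k)) (suc n C suc k) (suc n C suc (suc k)) ⟩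
    (suc n C suc k ℕ.+ suc k ℕ.* (suc n C suc k)) ℕ.+ suc (suc k) ℕ.* (suc n C suc (suc k))
      ≡⟨ ≡.cong₂ (λ a b → (suc n C suc k ℕ.+ a) ℕ.+ b) (absorption n k) (absorption n (suc k)) ⟩
    (suc n C suc k ℕ.+ suc n ℕ.* (n C k)) ℕ.+ suc n ℕ.* (n C suc k)
      ≡⟨ ℕP.+-assoc (suc n C suc k) _ _ ⟩
    suc n C suc k ℕ.+ (suc n ℕ.* (n C k) ℕ.+ suc n ℕ.* (n C suc k))
      ≡⟨ ≡.cong (suc n C suc k ℕ.+_) (≡.sym (ℕP.*-distribˡ-+ (suc n) (n C k) (n C suc k))) ⟩
    suc n C suc k ℕ.+ suc n ℕ.* (n C k ℕ.+ n C suc k)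
      ≡⟨ ≡.cong (λ a → suc n C suc k ℕ.+ suc n ℕ.* a) (nCk+nC[k+1]≡[n+1]C[k+1] n k) ⟩
    suc (suc n) ℕ.* (suc n C suc k) ∎
  where open ≡.≡-Reasoning

-- A prime p divides C(p,k) for 0 < k < p: p divides k·C(p,k) = p·C(p-1,k-1)
-- but not k.
prime∣binomial : ∀ q k → Prime (suc q) → 0 < k → k < suc q → suc q ∣ (suc q C k)
prime∣binomial q (suc k) isPrime _ k<p
  with euclidsLemma (suc k) (suc q C suc k) isPrime
         (≡.subst (suc q ∣_) (≡.sym (absorption q k)) (divides (q C k) (ℕP.*-comm (suc q) (q C k))))
... | inj₁ p∣k = ⊥-elim (ℕP.<⇒≱ k<p (∣⇒≤ p∣k))
... | inj₂ p∣C = p∣C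

-- In a commutative ring of prime characteristic p the Frobenius x ↦ xᵖ is
-- additive: all middle binomial coefficients of (a + b)ᵖ vanish.
module Frobenius {c ℓ} (K : CommutativeRing c ℓ) (q : ℕ) where
  open BK K (suc q) using (pow; ntimes)
  open CommutativeRing K hiding (zero) renaming (Carrier to k)
  open import Relation.Binary.Reasoning.Setoid setoid
  open import Algebra.Properties.Semiring.Exp semiring using (_^_)
  open import Algebra.Properties.Semiring.Mult semiring using (×-assoc-*)
  open import Algebra.Properties.Monoid.Mult +-monoid using (×-congʳ; ×-congˡ; ×-assocˡ) renaming (_×_ to _·_)
  open import Algebra.Properties.Monoid.Sum +-monoid using (sum; sum-cong-≋; sum-init-last; sum-replicate-zero)
  import Algebra.Properties.CommutativeSemiring.Binomial commutativeSemiring as Binomial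

  p : ℕ
  p = suc q

  pow≈^ : ∀ x n → pow x n ≈ x ^ n
  pow≈^ x zero    = refl
  pow≈^ x (suc n) = *-congˡ (pow≈^ x n)

  ntimes≈· : ∀ n x → ntimes n x ≈ n · x
  ntimes≈· zero    x = refl
  ntimes≈· (suc n) x = +-congˡ (ntimes≈· n x)

  module _ (prime : Prime p) (char : ntimes p 1# ≈ 0#) where

    multiple-of-p· : ∀ m x → (m ℕ.* p) · x ≈ 0#
    multiple-of-p· m x = begin
      (m ℕ.* p) · x           ≈⟨ ×-assocˡ x m p ⟨
      m · (p · x)             ≈⟨ ×-congʳ m p·x≈0 ⟩
      m · 0#                  ≈⟨ ·0 m ⟩
      0#                      ∎
      where
        p·x≈0 : p · x ≈ 0#
        p·x≈0 = begin
          p · x              ≈⟨ ×-congʳ p (*-identityˡ x) ⟨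
          p · (1# * x)       ≈⟨ ×-assoc-* p 1# x ⟨
          (p · 1#) * x       ≈⟨ *-congʳ (trans (sym (ntimes≈· p 1#)) char) ⟩
          0# * x             ≈⟨ zeroˡ x ⟩
          0#                 ∎
        ·0 : ∀ m → m · 0# ≈ 0#
        ·0 zero    = refl
        ·0 (suc m) = trans (+-identityˡ _) (·0 m)

    frobenius-+ : ∀ a b → pow (a + b) p ≈ pow a p + pow b p
    frobenius-+ a b = begin
      pow (a + b) p           ≈⟨ pow≈^ (a + b) p ⟩
      (a + b) ^ p             ≈⟨ Binomial.theorem p a b ⟩
      t zero + sum (λ j → t (suc j))
        ≈⟨ +-congˡ (sum-init-last (λ j → t (suc j))) ⟩
      t zero + (sum (λ j → t (suc (Fin.inject₁ j))) + t (suc (Fin.fromℕ q)))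
        ≈⟨ +-congˡ (+-congʳ (trans (sum-cong-≋ middle) (sum-replicate-zero q))) ⟩
      t zero + (0# + t (suc (Fin.fromℕ q)))
        ≈⟨ +-cong (trans (+-identityʳ _) (*-identityˡ _)) (trans (+-identityˡ _) last) ⟩
      b ^ p + a ^ p           ≈⟨ +-comm _ _ ⟩
      a ^ p + b ^ p           ≈⟨ +-cong (pow≈^ a p) (pow≈^ b p) ⟨
      pow a p + pow b p       ∎
      where
        t : Fin (suc p) → k
        t = Binomial.binomialTerm a b p
        middle : ∀ j → t (suc (Fin.inject₁ j)) ≈ 0#
        middle j with prime∣binomial q (suc (toℕ (Fin.inject₁ j))) prime (s≤s z≤n)
                        (s≤s (≡.subst (ℕ._< q) (≡.sym (FinP.toℕ-inject₁ j)) (FinP.toℕ<n j)))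
        ... | divides m eq = trans (×-congˡ eq) (multiple-of-p· m _)
        last : t (suc (Fin.fromℕ q)) ≈ a ^ p
        last rewrite FinP.toℕ-fromℕ q | nCn≡1 p | ℕP.n∸n≡0 q =
          trans (+-identityʳ _) (*-identityʳ _)

-- A surjective self-map F of a finite setoid is injective; we need the case
-- of the fibre over a fixed point: F z ≈ z and F x ≈ z give x ≈ z.
-- (Iterating a section σ of F must cycle, by the pigeonhole principle.)
module FiniteSurjection {a ℓ} (X : Setoid a ℓ) where
  open Setoid X renaming (Carrier to A)

  module _ (size : ℕ) (enum : Fin size → A) (enum-onto : ∀ x → ∃ λ i → enum i ≈ x)
           (F : A → A) (F-cong : ∀ {x y} → x ≈ y → F x ≈ F y)
           (F-onto : ∀ y → ∃ λ x → F x ≈ y) where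

    iterate : ℕ → A → A
    iterate zero    x = x
    iterate (suc m) x = iterate m (F x)

    iterate-cong : ∀ m {x y} → x ≈ y → iterate m x ≈ iterate m y
    iterate-cong zero    e = e
    iterate-cong (suc m) e = iterate-cong m (F-cong e)

    iterate-+ : ∀ m n x → iterate (m ℕ.+ n) x ≡ iterate n (iterate m x)
    iterate-+ zero    n x = ≡.refl
    iterate-+ (suc m) n x = iterate-+ m n (F x)

    iterate-fixed : ∀ m {z} → F z ≈ z → iterate m z ≈ z
    iterate-fixed zero    _  = refl
    iterate-fixed (suc m) Fz = trans (iterate-cong m Fz) (iterate-fixed m Fz)

    σ : Fin size → Fin size
    σ j = proj₁ (enum-onto (proj₁ (F-onto (enum j))))

    F-σ : ∀ j → F (enum (σ j)) ≈ enum j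
    F-σ j = trans (F-cong (proj₂ (enum-onto _))) (proj₂ (F-onto (enum j)))

    σ^ : ℕ → Fin size → Fin size
    σ^ zero    j = j
    σ^ (suc m) j = σ (σ^ m j)

    iterate-σ^ : ∀ m j → iterate m (enum (σ^ m j)) ≈ enum j
    iterate-σ^ zero    j = refl
    iterate-σ^ (suc m) j = trans (iterate-cong m (F-σ (σ^ m j))) (iterate-σ^ m j)

    fibre-of-fixed-point : ∀ {z} → F z ≈ z → ∀ x → F x ≈ z → x ≈ z
    fibre-of-fixed-point {z} Fz x Fx≈z
      with i , eᵢ ← enum-onto x
      with m₁ , m₂ , m₁<m₂ , σ-eq ← FinP.pigeonhole (ℕP.n<1+n size) (λ m → σ^ (toℕ m) i)
      = begin
        x                                                  ≈⟨ eᵢ ⟨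
        enum i                                             ≈⟨ iterate-σ^ (toℕ m₂) i ⟨
        iterate (toℕ m₂) (enum (σ^ (toℕ m₂) i))             ≡⟨ ≡.cong₂ (λ n j → iterate n (enum j)) m₂≡ (≡.sym σ-eq) ⟩
        iterate (toℕ m₁ ℕ.+ suc d) (enum (σ^ (toℕ m₁) i))  ≡⟨ iterate-+ (toℕ m₁) (suc d) _ ⟩
        iterate d (F (iterate (toℕ m₁) (enum (σ^ (toℕ m₁) i)))) ≈⟨ iterate-cong d (F-cong (iterate-σ^ (toℕ m₁) i)) ⟩
        iterate d (F (enum i))                             ≈⟨ iterate-cong d (trans (F-cong eᵢ) Fx≈z) ⟩
        iterate d z                                        ≈⟨ iterate-fixed d Fz ⟩
        z                                                  ∎
      where
        open SetoidReasoning X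
        d : ℕ
        d = toℕ m₂ ∸ suc (toℕ m₁)
        m₂≡ : toℕ m₂ ≡ toℕ m₁ ℕ.+ suc d
        m₂≡ = ≡.trans (≡.sym (ℕP.m+[n∸m]≡n m₁<m₂)) (≡.sym (ℕP.+-suc (toℕ m₁) d))

module Series {c ℓ} (K : CommutativeRing c ℓ) (p : ℕ) where
  open BK K p
  open CommutativeRing K hiding (zero) renaming (Carrier to k)
  open import Algebra.Properties.Ring ring using (-‿distribʳ-*; -‿+-comm; -0#≈0#)
  open import Algebra.Properties.CommutativeSemigroup +-commutativeSemigroup using (interchange)
  open SetoidReasoning setoid

  Σ≤-cong : ∀ n {h h′ : ℕ → k} → (∀ i → i ≤ n → h i ≈ h′ i) → Σ≤ n h ≈ Σ≤ n h′
  Σ≤-cong zero    e = e 0 z≤n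
  Σ≤-cong (suc n) e = +-cong (Σ≤-cong n (λ i i≤n → e i (ℕP.m≤n⇒m≤1+n i≤n))) (e (suc n) ℕP.≤-refl)

  Σ≤-+ : ∀ n (h h′ : ℕ → k) → Σ≤ n (λ i → h i + h′ i) ≈ Σ≤ n h + Σ≤ n h′
  Σ≤-+ zero    h h′ = refl
  Σ≤-+ (suc n) h h′ = trans (+-congʳ (Σ≤-+ n h h′)) (interchange _ _ _ _)

  Σ≤-*ˡ : ∀ n a (h : ℕ → k) → a * Σ≤ n h ≈ Σ≤ n (λ i → a * h i)
  Σ≤-*ˡ zero    a h = refl
  Σ≤-*ˡ (suc n) a h = trans (distribˡ a _ _) (+-congʳ (Σ≤-*ˡ n a h))

  Σ≤-*ʳ : ∀ n a (h : ℕ → k) → Σ≤ n h * a ≈ Σ≤ n (λ i → h i * a)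
  Σ≤-*ʳ zero    a h = refl
  Σ≤-*ʳ (suc n) a h = trans (distribʳ a _ _) (+-congʳ (Σ≤-*ʳ n a h))

  Σ≤-neg : ∀ n (h : ℕ → k) → Σ≤ n (λ i → - h i) ≈ - Σ≤ n h
  Σ≤-neg zero    h = refl
  Σ≤-neg (suc n) h = trans (+-congʳ (Σ≤-neg n h)) (-‿+-comm _ _)

  Σ≤-0 : ∀ n → Σ≤ n (λ _ → 0#) ≈ 0#
  Σ≤-0 zero    = refl
  Σ≤-0 (suc n) = trans (+-identityʳ _) (Σ≤-0 n)

  Σ≤-shift : ∀ n (h : ℕ → k) → Σ≤ (suc n) h ≈ h 0 + Σ≤ n (λ i → h (suc i))
  Σ≤-shift zero    h = refl
  Σ≤-shift (suc n) h = trans (+-congʳ (Σ≤-shift n h)) (+-assoc _ _ _)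

  Σ≤-triangle : ∀ n (G : ℕ → ℕ → k) →
    Σ≤ n (λ i → Σ≤ i (λ a → G a (i ∸ a))) ≈ Σ≤ n (λ a → Σ≤ (n ∸ a) (G a))
  Σ≤-triangle zero    G = refl
  Σ≤-triangle (suc n) G = begin
    Σ≤ (suc n) (λ i → Σ≤ i (λ a → G a (i ∸ a)))
      ≈⟨ Σ≤-shift n _ ⟩
    G 0 0 + Σ≤ n (λ i → Σ≤ (suc i) (λ a → G a (suc i ∸ a)))
      ≈⟨ +-congˡ (trans (Σ≤-cong n (λ i _ → Σ≤-shift i _)) (Σ≤-+ n _ _)) ⟩
    G 0 0 + (Σ≤ n (λ i → G 0 (suc i)) + Σ≤ n (λ i → Σ≤ i (λ a → G (suc a) (i ∸ a))))
      ≈⟨ +-assoc _ _ _ ⟨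
    (G 0 0 + Σ≤ n (λ i → G 0 (suc i))) + Σ≤ n (λ i → Σ≤ i (λ a → G (suc a) (i ∸ a)))
      ≈⟨ +-cong (Σ≤-shift n (G 0)) (sym (Σ≤-triangle n (λ a → G (suc a)))) ⟨
    Σ≤ (suc n) (G 0) + Σ≤ n (λ a → Σ≤ (n ∸ a) (G (suc a)))
      ≈⟨ Σ≤-shift n _ ⟨
    Σ≤ (suc n) (λ a → Σ≤ (suc n ∸ a) (G a)) ∎

  S-setoid : Setoid c ℓ
  S-setoid = record
    { Carrier = S ; _≈_ = _≈S_
    ; isEquivalence = record
      { refl = λ _ → refl ; sym = λ e n → sym (e n) ; trans = λ e e′ n → trans (e n) (e′ n) } }

  open Setoid S-setoid public using () renaming (refl to ≈S-refl; sym to ≈S-sym; trans to ≈S-trans)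

  negS : S → S
  negS f n = - f n

  +S-cong : ∀ {f f′ g g′} → f ≈S f′ → g ≈S g′ → (f +S g) ≈S (f′ +S g′)
  +S-cong e e′ n = +-cong (e n) (e′ n)

  sh-lt : ∀ m f n → n < m → sh m f n ≡ 0#
  sh-lt m f n n<m with n ℕP.<? m
  ... | yes _ = ≡.refl
  ... | no n≮m = ⊥-elim (n≮m n<m)

  sh-ge : ∀ m f n → m ≤ n → sh m f n ≡ f (n ∸ m)
  sh-ge m f n m≤n with n ℕP.<? m
  ... | yes n<m = ⊥-elim (ℕP.<⇒≱ n<m m≤n)
  ... | no _    = ≡.refl

  sh-suc-suc : ∀ m f n → sh (suc m) f (suc n) ≈ sh m f n
  sh-suc-suc m f n with n ℕP.<? m
  ... | yes n<m = reflexive (sh-lt (suc m) f (suc n) (s≤s n<m))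
  ... | no n≮m  = reflexive (sh-ge (suc m) f (suc n) (s≤s (ℕP.≮⇒≥ n≮m)))

  sh-cong : ∀ m {f g} → f ≈S g → sh m f ≈S sh m g
  sh-cong m e n with n ℕP.<? m
  ... | yes _ = refl
  ... | no _  = e (n ∸ m)

  sh-suc : ∀ m f → sh (suc m) f ≈S sh 1 (sh m f)
  sh-suc m f zero    = refl
  sh-suc m f (suc n) = sh-suc-suc m f n

  sh-add : ∀ a b f → sh a (sh b f) ≈S sh (a ℕ.+ b) f
  sh-add zero    b f n       = refl
  sh-add (suc a) b f zero    = refl
  sh-add (suc a) b f (suc n) =
    trans (sh-suc-suc a (sh b f) n) (trans (sh-add a b f n) (sym (sh-suc-suc (a ℕ.+ b) f n)))

  sh-at : ∀ m f n → sh m f (m ℕ.+ n) ≈ f n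
  sh-at zero    f n = refl
  sh-at (suc m) f n = trans (sh-suc-suc m f (m ℕ.+ n)) (sh-at m f n)

  sh-inj : ∀ m {f g} → sh m f ≈S sh m g → f ≈S g
  sh-inj m {f} {g} e n = trans (sym (sh-at m f n)) (trans (e (m ℕ.+ n)) (sh-at m g n))

  sh-+ : ∀ m f g → sh m (f +S g) ≈S (sh m f +S sh m g)
  sh-+ m f g n with n ℕP.<? m
  ... | yes _ = sym (+-identityʳ 0#)
  ... | no _  = refl

  sh-0 : ∀ m → sh m 0S ≈S 0S
  sh-0 m n with n ℕP.<? m
  ... | yes _ = refl
  ... | no _  = refl

  sh-neg : ∀ m f → sh m (negS f) ≈S negS (sh m f)
  sh-neg m f n with n ℕP.<? m
  ... | yes _ = sym -0#≈0#
  ... | no _  = refl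

  *S-cong : ∀ {f f′ g g′} → f ≈S f′ → g ≈S g′ → (f *S g) ≈S (f′ *S g′)
  *S-cong e e′ n = Σ≤-cong n (λ i _ → *-cong (e i) (e′ (n ∸ i)))

  *S-sh1ˡ : ∀ f g → (sh 1 f *S g) ≈S sh 1 (f *S g)
  *S-sh1ˡ f g zero    = zeroˡ _
  *S-sh1ˡ f g (suc n) = trans (Σ≤-shift n _) (trans (+-congʳ (zeroˡ _)) (+-identityˡ _))

  *S-sh1ʳ : ∀ f g → (f *S sh 1 g) ≈S sh 1 (f *S g)
  *S-sh1ʳ f g zero    = zeroʳ _
  *S-sh1ʳ f g (suc n) = trans (+-cong (Σ≤-cong n inner) last) (+-identityʳ _)
    where
      inner : ∀ i → i ≤ n → f i * sh 1 g (suc n ∸ i) ≈ f i * g (n ∸ i)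
      inner i i≤n = *-congˡ (reflexive (≡.cong (sh 1 g) (ℕP.+-∸-assoc 1 i≤n)))
      last : f (suc n) * sh 1 g (suc n ∸ suc n) ≈ 0#
      last = trans (*-congˡ (reflexive (≡.cong (sh 1 g) (ℕP.n∸n≡0 n)))) (zeroʳ _)

  *S-shˡ : ∀ m f g → (sh m f *S g) ≈S sh m (f *S g)
  *S-shˡ zero    f g = ≈S-refl
  *S-shˡ (suc m) f g =
    ≈S-trans (*S-cong (sh-suc m f) (≈S-refl {g})) (≈S-trans (*S-sh1ˡ (sh m f) g)
      (≈S-trans (sh-cong 1 (*S-shˡ m f g)) (≈S-sym (sh-suc m _))))

  *S-shʳ : ∀ m f g → (f *S sh m g) ≈S sh m (f *S g)
  *S-shʳ zero    f g = ≈S-refl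
  *S-shʳ (suc m) f g =
    ≈S-trans (*S-cong ≈S-refl (sh-suc m g)) (≈S-trans (*S-sh1ʳ f (sh m g))
      (≈S-trans (sh-cong 1 (*S-shʳ m f g)) (≈S-sym (sh-suc m _))))

  *S-distribˡ : ∀ f g h → (f *S (g +S h)) ≈S ((f *S g) +S (f *S h))
  *S-distribˡ f g h n = trans (Σ≤-cong n (λ i _ → distribˡ _ _ _)) (Σ≤-+ n _ _)

  *S-distribʳ : ∀ f g h → ((g +S h) *S f) ≈S ((g *S f) +S (h *S f))
  *S-distribʳ f g h n = trans (Σ≤-cong n (λ i _ → distribʳ _ _ _)) (Σ≤-+ n _ _)

  *S-zeroˡ : ∀ f → (0S *S f) ≈S 0S
  *S-zeroˡ f n = trans (Σ≤-cong n (λ i _ → zeroˡ _)) (Σ≤-0 n)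

  *S-zeroʳ : ∀ f → (f *S 0S) ≈S 0S
  *S-zeroʳ f n = trans (Σ≤-cong n (λ i _ → zeroʳ _)) (Σ≤-0 n)

  *S-negʳ : ∀ f g → (f *S negS g) ≈S negS (f *S g)
  *S-negʳ f g n = trans (Σ≤-cong n (λ i _ → sym (-‿distribʳ-* _ _))) (Σ≤-neg n _)

  *S-identityˡ : ∀ f → (1S *S f) ≈S f
  *S-identityˡ f zero    = *-identityˡ _
  *S-identityˡ f (suc n) = trans (Σ≤-shift n _)
    (trans (+-cong (*-identityˡ _) (trans (Σ≤-cong n (λ i _ → zeroˡ _)) (Σ≤-0 n))) (+-identityʳ _))

  *S-assoc : ∀ f g h → ((f *S g) *S h) ≈S (f *S (g *S h))
  *S-assoc f g h n = begin
    Σ≤ n (λ i → Σ≤ i (λ a → f a * g (i ∸ a)) * h (n ∸ i))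
      ≈⟨ Σ≤-cong n (λ i i≤n → trans (Σ≤-*ʳ i _ _) (Σ≤-cong i (λ a a≤i → regroup i a i≤n a≤i))) ⟩
    Σ≤ n (λ i → Σ≤ i (λ a → G a (i ∸ a)))
      ≈⟨ Σ≤-triangle n G ⟩
    Σ≤ n (λ a → Σ≤ (n ∸ a) (G a))
      ≈⟨ Σ≤-cong n (λ a _ → trans (Σ≤-cong (n ∸ a) (λ b _ → *-congˡ (*-congˡ (reflexive
           (≡.cong h (≡.sym (ℕP.∸-+-assoc n a b))))))) (sym (Σ≤-*ˡ (n ∸ a) _ _))) ⟩
    Σ≤ n (λ a → f a * Σ≤ (n ∸ a) (λ b → g b * h (n ∸ a ∸ b))) ∎
    where
      G : ℕ → ℕ → k
      G a b = f a * (g b * h (n ∸ (a ℕ.+ b)))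
      regroup : ∀ i a → i ≤ n → a ≤ i → (f a * g (i ∸ a)) * h (n ∸ i) ≈ G a (i ∸ a)
      regroup i a i≤n a≤i = trans (*-assoc _ _ _)
        (*-congˡ (*-congˡ (reflexive (≡.cong (λ j → h (n ∸ j)) (≡.sym (ℕP.m+[n∸m]≡n a≤i))))))

  V-setoid : ℕ → Setoid c ℓ
  V-setoid n = record
    { Carrier = V n ; _≈_ = _≈V_
    ; isEquivalence = record
      { refl = λ _ → ≈S-refl ; sym = λ e i → ≈S-sym (e i) ; trans = λ e e′ i → ≈S-trans (e i) (e′ i) } }

  module _ {n : ℕ} where
    open Setoid (V-setoid n) public using ()
      renaming (refl to ≈V-refl; sym to ≈V-sym; trans to ≈V-trans; reflexive to ≈V-reflexive)

  negV : ∀ {n} → V n → V n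
  negV x i = negS (x i)

  _-V_ : ∀ {n} → V n → V n → V n
  x -V y = x +V negV y

  +V-cong : ∀ {n} {x x′ y y′ : V n} → x ≈V x′ → y ≈V y′ → (x +V y) ≈V (x′ +V y′)
  +V-cong e e′ i = +S-cong (e i) (e′ i)

  -V-cong : ∀ {n} {x x′ y y′ : V n} → x ≈V x′ → y ≈V y′ → (x -V y) ≈V (x′ -V y′)
  -V-cong e e′ i n = +-cong (e i n) (-‿cong (e′ i n))

  +V-identityʳ : ∀ {n} (x : V n) → (x +V 0V) ≈V x
  +V-identityʳ x i n = +-identityʳ _

  -V-self : ∀ {n} (x : V n) → (x -V x) ≈V 0V
  -V-self x i n = -‿inverseʳ _

  +V-cancelʳ : ∀ {n} (x y : V n) → ((x +V y) -V y) ≈V x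
  +V-cancelʳ x y i n = trans (+-assoc _ _ _) (trans (+-congˡ (-‿inverseʳ _)) (+-identityʳ _))

  -V≈0⇒≈ : ∀ {n} {x y : V n} → (x -V y) ≈V 0V → x ≈V y
  -V≈0⇒≈ {x = x} {y} e i n = x∙y⁻¹≈ε⇒x≈y (x i n) (y i n) (e i n)
    where open import Algebra.Properties.Group +-group using (x∙y⁻¹≈ε⇒x≈y)

  shV-zero : ∀ {n} (x : V n) → shV 0 x ≈V x
  shV-zero x i n = refl

  diff/u : ∀ {n} → V n → V n → V n
  diff/u x y l m = x l (suc m) - y l (suc m)

  ≡u⇒constant : ∀ {n} {x y : V n} t → x ≈V (y +V shV 1 t) → ∀ l → x l 0 ≈ y l 0
  ≡u⇒constant t e l = trans (e l 0) (+-identityʳ _)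

  constant⇒≡u : ∀ {n} {x y : V n} → (∀ l → x l 0 ≈ y l 0) → x ≈V (y +V shV 1 (diff/u x y))
  constant⇒≡u e l zero    = trans (e l) (sym (+-identityʳ _))
  constant⇒≡u {x = x} {y} e l (suc m) = begin
    x l (suc m)                          ≈⟨ +-identityˡ _ ⟨
    0# + x l (suc m)                     ≈⟨ +-congʳ (-‿inverseʳ _) ⟨
    (y l (suc m) - y l (suc m)) + x l (suc m) ≈⟨ +-assoc _ _ _ ⟩
    y l (suc m) + (- y l (suc m) + x l (suc m)) ≈⟨ +-congˡ (+-comm _ _) ⟩
    y l (suc m) + (x l (suc m) - y l (suc m)) ∎

  ≡u-refl : ∀ {n} (x : V n) → x ≈V (x +V shV 1 0V)
  ≡u-refl x = ≈V-sym (≈V-trans (+V-cong ≈V-refl (λ _ → sh-0 1)) (+V-identityʳ x))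

  shV-cong : ∀ {n} m {x y : V n} → x ≈V y → shV m x ≈V shV m y
  shV-cong m e i = sh-cong m (e i)

  shV-add : ∀ {n} a b (x : V n) → shV a (shV b x) ≈V shV (a ℕ.+ b) x
  shV-add a b x i = sh-add a b (x i)

  shV-comm : ∀ {n} a b (x : V n) → shV a (shV b x) ≈V shV b (shV a x)
  shV-comm a b x = ≈V-trans (shV-add a b x)
    (≈V-trans (≈V-reflexive (≡.cong (λ m → shV m x) (ℕP.+-comm a b))) (≈V-sym (shV-add b a x)))

  shV-inj : ∀ {n} m {x y : V n} → shV m x ≈V shV m y → x ≈V y
  shV-inj m e i = sh-inj m (e i)

  shV-+ : ∀ {n} m (x y : V n) → shV m (x +V y) ≈V (shV m x +V shV m y)
  shV-+ m x y i = sh-+ m (x i) (y i)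

  shV--V : ∀ {n} m (x y : V n) → shV m (x -V y) ≈V (shV m x -V shV m y)
  shV--V m x y i = ≈S-trans (sh-+ m (x i) _) (+S-cong ≈S-refl (sh-neg m (y i)))

  shV-0 : ∀ {n} m → shV {n} m 0V ≈V 0V
  shV-0 m i = sh-0 m

  ΣFin-cong : ∀ n {h h′ : Fin n → S} → (∀ j → h j ≈S h′ j) → ΣFin n h ≈S ΣFin n h′
  ΣFin-cong zero    e = ≈S-refl
  ΣFin-cong (suc n) e = +S-cong (e zero) (ΣFin-cong n (λ j → e (suc j)))

  ΣFin-+ : ∀ n (h h′ : Fin n → S) → ΣFin n (λ j → h j +S h′ j) ≈S (ΣFin n h +S ΣFin n h′)
  ΣFin-+ zero    h h′ m = sym (+-identityʳ 0#)
  ΣFin-+ (suc n) h h′ m = trans (+-congˡ (ΣFin-+ n _ _ m)) (interchange _ _ _ _)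

  ΣFin-0 : ∀ n → ΣFin n (λ _ → 0S) ≈S 0S
  ΣFin-0 zero      = ≈S-refl
  ΣFin-0 (suc n) m = trans (+-congˡ (ΣFin-0 n m)) (+-identityʳ 0#)

  ΣFin-neg : ∀ n (h : Fin n → S) → ΣFin n (λ j → negS (h j)) ≈S negS (ΣFin n h)
  ΣFin-neg zero    h m = sym -0#≈0#
  ΣFin-neg (suc n) h m = trans (+-congˡ (ΣFin-neg n _ m)) (-‿+-comm _ _)

  ΣFin-sh : ∀ n e (h : Fin n → S) → ΣFin n (λ j → sh e (h j)) ≈S sh e (ΣFin n h)
  ΣFin-sh zero    e h = ≈S-sym (sh-0 e)
  ΣFin-sh (suc n) e h = ≈S-trans (+S-cong ≈S-refl (ΣFin-sh n e _)) (≈S-sym (sh-+ e _ _))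

  ΣFin-*ˡ : ∀ n f (h : Fin n → S) → (f *S ΣFin n h) ≈S ΣFin n (λ j → f *S h j)
  ΣFin-*ˡ zero    f h = *S-zeroʳ f
  ΣFin-*ˡ (suc n) f h = ≈S-trans (*S-distribˡ f (h zero) (ΣFin n (λ j → h (suc j)))) (+S-cong ≈S-refl (ΣFin-*ˡ n f (λ j → h (suc j))))

  ΣFin-*ʳ : ∀ n f (h : Fin n → S) → (ΣFin n h *S f) ≈S ΣFin n (λ j → h j *S f)
  ΣFin-*ʳ zero    f h = *S-zeroˡ f
  ΣFin-*ʳ (suc n) f h = ≈S-trans (*S-distribʳ f (h zero) (ΣFin n (λ j → h (suc j)))) (+S-cong ≈S-refl (ΣFin-*ʳ n f (λ j → h (suc j))))

  ΣFin-swap : ∀ n m (h : Fin n → Fin m → S) →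
    ΣFin n (λ j → ΣFin m (h j)) ≈S ΣFin m (λ l → ΣFin n (λ j → h j l))
  ΣFin-swap zero    m h = ≈S-sym (ΣFin-0 m)
  ΣFin-swap (suc n) m h = ≈S-trans (+S-cong ≈S-refl (ΣFin-swap n m _)) (≈S-sym (ΣFin-+ m _ _))

  ΣFin-δ : ∀ n (i : Fin n) (h : Fin n → S) → (∀ j → i ≢ j → h j ≈S 0S) → ΣFin n h ≈S h i
  ΣFin-δ (suc n) zero h off m =
    trans (+-congˡ (trans (ΣFin-cong n (λ j → off (suc j) (λ ())) m) (ΣFin-0 n m))) (+-identityʳ _)
  ΣFin-δ (suc n) (suc i) h off m =
    trans (+-congʳ (off zero (λ ()) m)) (trans (+-identityˡ _)
      (ΣFin-δ n i (λ j → h (suc j)) (λ j i≢j → off (suc j) (λ e → i≢j (FinP.suc-injective e))) m))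

  app-cong : ∀ {m n} (A : Mat m n) {x y : V n} → x ≈V y → app A x ≈V app A y
  app-cong {n = n} A e i = ΣFin-cong n (λ j → *S-cong ≈S-refl (e j))

  app-congˡ : ∀ {m n} {A B : Mat m n} (x : V n) → A ≈M B → app A x ≈V app B x
  app-congˡ {n = n} x e i = ΣFin-cong n (λ j → *S-cong (e i j) (≈S-refl {x j}))

  app-+ : ∀ {m n} (A : Mat m n) (x y : V n) → app A (x +V y) ≈V (app A x +V app A y)
  app-+ {n = n} A x y i = ≈S-trans (ΣFin-cong n (λ j → *S-distribˡ (A i j) (x j) (y j))) (ΣFin-+ n _ _)

  app--V : ∀ {m n} (A : Mat m n) (x y : V n) → app A (x -V y) ≈V (app A x -V app A y)
  app--V {n = n} A x y = ≈V-trans (app-+ A x (negV y))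
    (+V-cong ≈V-refl (λ i → ≈S-trans (ΣFin-cong n (λ j → *S-negʳ (A i j) (y j))) (ΣFin-neg n _)))

  app-0 : ∀ {m n} (A : Mat m n) → app A 0V ≈V 0V
  app-0 {n = n} A i = ≈S-trans (ΣFin-cong n (λ j → *S-zeroʳ (A i j))) (ΣFin-0 n)

  app-sh : ∀ {m n} (A : Mat m n) e (x : V n) → app A (shV e x) ≈V shV e (app A x)
  app-sh {n = n} A e x i = ≈S-trans (ΣFin-cong n (λ j → *S-shʳ e (A i j) (x j))) (ΣFin-sh n e _)

  app-·M : ∀ {m n r} (A : Mat m n) (B : Mat n r) (x : V r) → app A (app B x) ≈V app (A ·M B) x
  app-·M {n = n} {r} A B x i =
    ≈S-trans (ΣFin-cong n (λ l → ΣFin-*ˡ r (A i l) _))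
      (≈S-trans (ΣFin-swap n r _) (ΣFin-cong r (λ j →
        ≈S-trans (ΣFin-cong n (λ l → ≈S-sym (*S-assoc (A i l) (B l j) (x j)))) (≈S-sym (ΣFin-*ʳ n (x j) _)))))

  app-uId : ∀ {n} e (x : V n) → app (uId e) x ≈V shV e x
  app-uId {n} e x i = ≈S-trans (ΣFin-δ n i _ off-diagonal)
      (≈S-trans (*S-cong (diagonal i) (≈S-refl {x i})) (≈S-trans (*S-shˡ e 1S (x i)) (sh-cong e (*S-identityˡ (x i)))))
    where
      diagonal : ∀ i → uId e i i ≈S sh e 1S
      diagonal i with i Fin.≟ i
      ... | yes _ = ≈S-refl
      ... | no i≢i = ⊥-elim (i≢i ≡.refl)
      off-diagonal : ∀ j → i ≢ j → (uId e i j *S x j) ≈S 0S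
      off-diagonal j i≢j with i Fin.≟ j
      ... | yes i≡j = ⊥-elim (i≢j i≡j)
      ... | no _    = *S-zeroˡ (x j)

module FrobeniusSeries {c ℓ} (K : CommutativeRing c ℓ) (q : ℕ) where
  open BK K (suc q)
  open Series K (suc q)
  open CommutativeRing K hiding (zero) renaming (Carrier to k)

  p : ℕ
  p = suc q

  pow-cong : ∀ n {x y} → x ≈ y → pow x n ≈ pow y n
  pow-cong zero    e = refl
  pow-cong (suc n) e = *-cong e (pow-cong n e)

  frobS-divisible : ∀ f n → n % p ≡ 0 → frobS f n ≡ pow (f (n / p)) p
  frobS-divisible f n n%p≡0 with n % p ℕP.≟ 0
  ... | yes _     = ≡.refl
  ... | no n%p≢0  = ⊥-elim (n%p≢0 n%p≡0)

  frobS-indivisible : ∀ f n → n % p ≢ 0 → frobS f n ≡ 0#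
  frobS-indivisible f n n%p≢0 with n % p ℕP.≟ 0
  ... | yes n%p≡0 = ⊥-elim (n%p≢0 n%p≡0)
  ... | no _      = ≡.refl

  frobS-constant : ∀ f → frobS f 0 ≈ pow (f 0) p
  frobS-constant f = reflexive (frobS-divisible f 0 ≡.refl)

  frobS-cong : ∀ {f g} → f ≈S g → frobS f ≈S frobS g
  frobS-cong e n with n % p ℕP.≟ 0
  ... | yes _ = pow-cong p (e _)
  ... | no _  = refl

  frobS-0 : frobS 0S ≈S 0S
  frobS-0 n with n % p ℕP.≟ 0
  ... | yes _ = zeroˡ _
  ... | no _  = refl

  residue-∸p : ∀ {n} → p ≤ n → n % p ≡ (n ∸ p) % p
  residue-∸p {n} p≤n = ≡.trans (≡.cong (_% p) (≡.sym (ℕP.m∸n+n≡m p≤n))) ([m+n]%n≡m%n (n ∸ p) p)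

  frobS-sh1 : ∀ f → frobS (sh 1 f) ≈S sh p (frobS f)
  frobS-sh1 f n = by-cases (n ℕP.<? p)
    where
      below : ∀ n → n < p → frobS (sh 1 f) n ≈ 0#
      below zero    _     = trans (frobS-constant (sh 1 f)) (zeroˡ _)
      below (suc n) 1+n<p = reflexive (frobS-indivisible (sh 1 f) (suc n)
        (λ e → ℕP.1+n≢0 (≡.trans (≡.sym (m<n⇒m%n≡m 1+n<p)) e)))
      above : p ≤ n → Dec ((n ∸ p) % p ≡ 0) → frobS (sh 1 f) n ≈ frobS f (n ∸ p)
      above p≤n (yes e) = trans (reflexive (frobS-divisible (sh 1 f) n (≡.trans (residue-∸p p≤n) e)))
          (trans (reflexive (≡.cong (λ m → pow (sh 1 f m) p) (m/n≡1+[m∸n]/n p≤n)))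
                 (sym (reflexive (frobS-divisible f (n ∸ p) e))))
      above p≤n (no ne) = trans (reflexive (frobS-indivisible (sh 1 f) n (λ e → ne (≡.trans (≡.sym (residue-∸p p≤n)) e))))
          (sym (reflexive (frobS-indivisible f (n ∸ p) ne)))
      by-cases : Dec (n < p) → frobS (sh 1 f) n ≈ sh p (frobS f) n
      by-cases (yes n<p) = trans (below n n<p) (sym (reflexive (sh-lt p (frobS f) n n<p)))
      by-cases (no n≮p)  = trans (above (ℕP.≮⇒≥ n≮p) ((n ∸ p) % p ℕP.≟ 0))
                                 (sym (reflexive (sh-ge p (frobS f) n (ℕP.≮⇒≥ n≮p))))

  frobV-cong : ∀ {n} {x y : V n} → x ≈V y → frobV x ≈V frobV y
  frobV-cong e i = frobS-cong (e i)

  frobV-0 : ∀ {n} → frobV {n} 0V ≈V 0V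
  frobV-0 i = frobS-0

  frobV-sh1 : ∀ {n} (x : V n) → frobV (shV 1 x) ≈V shV p (frobV x)
  frobV-sh1 x i = frobS-sh1 (x i)

  module Additive (frobenius-+ : ∀ a b → pow (a + b) p ≈ pow a p + pow b p) where

    frobV-+ : ∀ {n} (x y : V n) → frobV (x +V y) ≈V (frobV x +V frobV y)
    frobV-+ x y i n with n % p ℕP.≟ 0
    ... | yes _ = frobenius-+ _ _
    ... | no _  = sym (+-identityʳ 0#)

    app-frobV-split : ∀ {m n} (A : Mat m n) (y z : V n) →
      app A (frobV (y +V shV 1 z)) ≈V (app A (frobV y) +V shV p (app A (frobV z)))
    app-frobV-split A y z = begin
      app A (frobV (y +V shV 1 z))              ≈⟨ app-cong A (frobV-+ y (shV 1 z)) ⟩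
      app A (frobV y +V frobV (shV 1 z))        ≈⟨ app-cong A (+V-cong (≈V-refl {x = frobV y}) (frobV-sh1 z)) ⟩
      app A (frobV y +V shV p (frobV z))        ≈⟨ app-+ A (frobV y) (shV p (frobV z)) ⟩
      app A (frobV y) +V app A (shV p (frobV z)) ≈⟨ +V-cong (≈V-refl {x = app A (frobV y)}) (app-sh A p (frobV z)) ⟩
      app A (frobV y) +V shV p (app A (frobV z)) ∎
      where open SetoidReasoning (V-setoid _)

module Laurent {c ℓ} (K : CommutativeRing c ℓ) (p : ℕ) where
  open BK K p
  open Series K p
  open CommutativeRing K hiding (zero) renaming (Carrier to k)

  ~-sym : ∀ {n} (a b : L n) → a ~ b → b ~ a
  ~-sym _ _ e = ≈V-sym e

  ~-trans : ∀ {n} (a b d : L n) → a ~ b → b ~ d → a ~ d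
  ~-trans {n} (m , v) (m′ , v′) (m″ , v″) e₁ e₂ = shV-inj m′ (begin
      shV m′ (shV m″ v)   ≈⟨ shV-comm m′ m″ v ⟩
      shV m″ (shV m′ v)   ≈⟨ shV-cong m″ e₁ ⟩
      shV m″ (shV m v′)   ≈⟨ shV-comm m″ m v′ ⟩
      shV m (shV m″ v′)   ≈⟨ shV-cong m e₂ ⟩
      shV m (shV m′ v″)   ≈⟨ shV-comm m m′ v″ ⟩
      shV m′ (shV m v″)   ∎)
    where open SetoidReasoning (V-setoid n)

  ~-same-den : ∀ {n} d {v v′ : V n} → v ≈V v′ → (d , v) ~ (d , v′)
  ~-same-den d e = shV-cong d e

  ~-app : ∀ {m n} (A : Mat m n) {d d′} {v v′ : V n} → (d , v) ~ (d′ , v′) → (d , app A v) ~ (d′ , app A v′)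
  ~-app A {d} {d′} {v} {v′} e = ≈V-trans (≈V-sym (app-sh A d′ v)) (≈V-trans (app-cong A e) (app-sh A d v′))

  InUX-resp : ∀ {n} i (a b : L n) → a ~ b → InUX i b → InUX i a
  InUX-resp i a b e (w , b~uⁱw) = w , ~-trans a b (uPow i w) e b~uⁱw

  InUX-app : ∀ {m n} (A : Mat m n) i d (v : V n) → InUX i (d , v) → InUX i (d , app A v)
  InUX-app A i d v (w , e) = app A w ,
      ~-trans (d , app A v) (proj₁ (uPow i w) , app A (proj₂ (uPow i w))) (uPow i (app A w))
        (~-app A {d} {proj₁ (uPow i w)} {v} {proj₂ (uPow i w)} e) (app-uPow i)
    where
      app-uPow : ∀ i → (proj₁ (uPow i w) , app A (proj₂ (uPow i w))) ~ uPow i (app A w)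
      app-uPow (+ j)    = ~-same-den 0 (app-sh A j w)
      app-uPow -[1+ j ] = ~-same-den (suc j) ≈V-refl

  InUX-den : ∀ {n} d (v : V n) → InUX -[1+ d ] (d , v)
  InUX-den d v = shV 1 v , ≈V-sym (≈V-trans (shV-add d 1 v) (≈V-reflexive (≡.cong (λ m → shV m v) (ℕP.+-comm d 1))))

  InUX-0 : ∀ {n} i d {v : V n} → v ≈V 0V → InUX i (d , v)
  InUX-0 i d {v} v≈0 = 0V , zero-rep i
    where
      zero-rep : ∀ i → (d , v) ~ uPow i 0V
      zero-rep (+ j)    = ≈V-trans (shV-cong 0 v≈0) (≈V-trans (shV-0 0)
                            (≈V-sym (≈V-trans (shV-cong d (shV-0 j)) (shV-0 d))))
      zero-rep -[1+ j ] = ≈V-trans (shV-cong (suc j) v≈0) (≈V-trans (shV-0 (suc j)) (≈V-sym (shV-0 d)))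

  InUX-drop : ∀ {n} i m → i ℤ.≤ + m → ∀ d (y w : V n) →
    InUX i (d , (y +V shV m (shV d w))) → InUX i (d , y)
  InUX-drop {n} (+ j) m (ℤ.+≤+ j≤m) d y w (w′ , e) = w′ -V shV (m ∸ j) w , (begin
      shV 0 y                                             ≈⟨ ≈V-sym (+V-cancelʳ y _) ⟩
      (y +V shV m (shV d w)) -V shV m (shV d w)          ≈⟨ -V-cong e uᵐw ⟩
      shV d (shV j w′) -V shV d (shV j (shV (m ∸ j) w))   ≈⟨ ≈V-sym (shV--V d _ _) ⟩
      shV d (shV j w′ -V shV j (shV (m ∸ j) w))           ≈⟨ shV-cong d (≈V-sym (shV--V j _ _)) ⟩
      shV d (shV j (w′ -V shV (m ∸ j) w))                 ∎)
    where
      open SetoidReasoning (V-setoid n)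
      uᵐw : shV m (shV d w) ≈V shV d (shV j (shV (m ∸ j) w))
      uᵐw = ≈V-trans (shV-comm m d w) (shV-cong d (≈V-trans
              (≈V-reflexive (≡.cong (λ e → shV e w) (≡.sym (ℕP.m+[n∸m]≡n j≤m)))) (≈V-sym (shV-add j (m ∸ j) w))))
  InUX-drop {n} -[1+ j ] m ℤ.-≤+ d y w (w′ , e) = w′ -V shV (suc j ℕ.+ m) w , (begin
      shV (suc j) y                                          ≈⟨ shV-cong (suc j) (≈V-sym (+V-cancelʳ y _)) ⟩
      shV (suc j) ((y +V shV m (shV d w)) -V shV m (shV d w)) ≈⟨ shV--V (suc j) _ _ ⟩
      shV (suc j) (y +V shV m (shV d w)) -V shV (suc j) (shV m (shV d w)) ≈⟨ -V-cong e uᵐw ⟩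
      shV d w′ -V shV d (shV (suc j ℕ.+ m) w)                ≈⟨ ≈V-sym (shV--V d _ _) ⟩
      shV d (w′ -V shV (suc j ℕ.+ m) w)                      ∎)
    where
      open SetoidReasoning (V-setoid n)
      uᵐw : shV (suc j) (shV m (shV d w)) ≈V shV d (shV (suc j ℕ.+ m) w)
      uᵐw = ≈V-trans (shV-add (suc j) m _) (shV-comm (suc j ℕ.+ m) d w)

module Morphisms {c ℓ} (K : CommutativeRing c ℓ) (q : ℕ) where
  open BK K (suc q)
  open Series K (suc q)
  open FrobeniusSeries K q using (frobV-cong)
  open Laurent K (suc q)

  φX-cong : ∀ X {x y : V (Obj.rank X)} → x ≈V y → φX X x ~ φX X y
  φX-cong X e = ~-same-den (Obj.den X) (app-cong (Obj.mat X) (frobV-cong e))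

  Hom-filtered : ∀ {M N} (f : Hom M N) i x → FilXk M i x → FilXk N i (apply f x)
  Hom-filtered {M} {N} f i x (t , φx∈uⁱ) =
    app F t , InUX-resp i (φX N (app F x +V shV 1 (app F t))) (Obj.den M , app F (app AM (frobV y)))
      (~-trans (φX N (app F x +V shV 1 (app F t))) (φX N (app F y)) (Obj.den M , app F (app AM (frobV y)))
        (φX-cong N linear) (Hom.comm f y))
      (InUX-app F i (Obj.den M) (app AM (frobV y)) φx∈uⁱ)
    where
      F : Mat (Obj.rank N) (Obj.rank M)
      F = Hom.hmat f
      AM : Mat (Obj.rank M) (Obj.rank M)
      AM = Obj.mat M
      y : V (Obj.rank M)
      y = x +V shV 1 t
      linear : (app F x +V shV 1 (app F t)) ≈V app F y
      linear = ≈V-sym (≈V-trans (app-+ F x (shV 1 t)) (+V-cong ≈V-refl (app-sh F 1 t)))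

  -- In a short exact sequence the image of M is saturated in N:
  -- f(v) ∈ uⁱ N[1/u] forces v ∈ uⁱ M[1/u], because P has no u-torsion.
  module Saturation {M N P : Obj} (f : Hom M N) (g : Hom N P) (exact : ShortExact f g) where
    open ShortExact exact
    F : Mat (Obj.rank N) (Obj.rank M)
    F = Hom.hmat f
    G : Mat (Obj.rank P) (Obj.rank N)
    G = Hom.hmat g

    saturated-sh : ∀ m v w → app F v ≈V shV m w → ∃ λ z → v ≈V shV m z
    saturated-sh m v w fv≈uᵐw = z , -V≈0⇒≈ (f-inj _ f[v-uᵐz]≈0)
      where
        gw≈0 : app G w ≈V 0V
        gw≈0 = shV-inj m (≈V-trans (≈V-sym (app-sh G m w))
          (≈V-trans (app-cong G (≈V-sym fv≈uᵐw)) (≈V-trans (gf≈0 v) (≈V-sym (shV-0 m)))))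
        z : V (Obj.rank M)
        z = proj₁ (ker⊆im w gw≈0)
        fz≈w : apply f z ≈V w
        fz≈w = proj₂ (ker⊆im w gw≈0)
        f[v-uᵐz]≈0 : apply f (v -V shV m z) ≈V 0V
        f[v-uᵐz]≈0 = ≈V-trans (app--V F v (shV m z))
          (≈V-trans (-V-cong fv≈uᵐw (≈V-trans (app-sh F m z) (shV-cong m fz≈w))) (-V-self _))

    saturated : ∀ i d v → InUX i (d , app F v) → InUX i (d , v)
    saturated (+ j) d v (w , e) =
      let z , v≈uᵈ⁺ʲz = saturated-sh (d ℕ.+ j) v w (≈V-trans e (shV-add d j w))
      in z , ≈V-trans v≈uᵈ⁺ʲz (≈V-sym (shV-add d j z))
    saturated -[1+ j ] d v (w , e′) with d ℕP.≤? suc j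
    -- a small denominator d ≤ j + 1 puts u⁻ᵈ v in u^{-(j+1)} M outright
    ... | yes d≤j+1 = shV (suc j ∸ d) v , ≈V-trans
            (≈V-reflexive (≡.cong (λ m → shV m v) (≡.sym (ℕP.m+[n∸m]≡n d≤j+1))))
            (≈V-sym (shV-add d (suc j ∸ d) v))
    ... | no d≰j+1 = below (d ∸ suc j) (≡.sym (ℕP.m+[n∸m]≡n (ℕP.<⇒≤ (ℕP.≰⇒> d≰j+1))))
      where
        below : ∀ e → d ≡ suc j ℕ.+ e → InUX -[1+ j ] (d , v)
        below e d≡ =
          let z , v≈uᵉz = saturated-sh e v w (shV-inj (suc j) (≈V-trans e′
                            (≈V-trans (≈V-reflexive (≡.cong (λ m → shV m w) d≡)) (≈V-sym (shV-add (suc j) e w)))))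
          in z , ≈V-trans (shV-cong (suc j) v≈uᵉz)
                  (≈V-trans (shV-add (suc j) e z) (≈V-reflexive (≡.cong (λ m → shV m z) (≡.sym d≡))))

module StronglyDivisibleFacts {c ℓ} (K : CommutativeRing c ℓ) (q : ℕ)
    (field-k : BK.IsFiniteFieldOfChar K (suc q))
    (N : BK.Obj K (suc q)) (sd : BK.StronglyDivisible K (suc q) N) where
  open BK K (suc q)
  open CommutativeRing K hiding (zero) renaming (Carrier to k)
  open IsFiniteFieldOfChar field-k
  open Series K (suc q)
  open FrobeniusSeries K q
  open Additive (Frobenius.frobenius-+ K q prime char)
  open Laurent K (suc q)
  open Obj N
  open StronglyDivisible sd

  -- every b ∈ k is a p-th power: the vector with all coefficients b lies in
  -- F^{-den-1} N^φ_k, which by strong divisibility is the image of N_k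
  pth-root : Fin rank → ∀ b → ∃ λ a → pow a p ≈ b
  pth-root l b with x , _ , s , φx≡b ← onto -[1+ den ] (λ _ _ → b) (0V , InUX-den den _)
    = x l 0 , trans (sym (frobS-constant (x l))) (≡u⇒constant s φx≡b l)

  -- hence, k being finite, x ↦ xᵖ is injective
  frobenius-injective : Fin rank → ∀ {a b} → pow a p ≈ pow b p → a ≈ b
  frobenius-injective l {a} {b} aᵖ≈bᵖ = x∙y⁻¹≈ε⇒x≈y a b (nilpotent-zero (a - b) [a-b]ᵖ≈0)
    where
      open import Algebra.Properties.Group +-group using (x∙y⁻¹≈ε⇒x≈y; ∙-cancelʳ)
      nilpotent-zero : ∀ x → pow x p ≈ 0# → x ≈ 0#
      nilpotent-zero = FiniteSurjection.fibre-of-fixed-point setoid size enum enum-onto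
                         (λ x → pow x p) (pow-cong p) (pth-root l) (zeroˡ _)
      [a-b]ᵖ≈0 : pow (a - b) p ≈ 0#
      [a-b]ᵖ≈0 = ∙-cancelʳ (pow b p) _ _ (begin
        pow (a - b) p + pow b p    ≈⟨ Frobenius.frobenius-+ K q prime char (a - b) b ⟨
        pow ((a - b) + b) p        ≈⟨ pow-cong p (trans (+-assoc _ _ _) (trans (+-congˡ (-‿inverseˡ b)) (+-identityʳ a))) ⟩
        pow a p                    ≈⟨ aᵖ≈bᵖ ⟩
        pow b p                    ≈⟨ +-identityˡ _ ⟨
        0# + pow b p               ∎)
        where open SetoidReasoning setoid

  -- Weight(N) ⊆ [0,p]: the filtration of N^φ_k is constant below 0 and above p
  Fφ-up-to-0 : ∀ m y → FilXφk N -[1+ m ] y → FilXφk N (+ 0) y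
  Fφ-up-to-0 zero    y y∈F = weight -[1+ 0 ] (inj₁ ℤ.-<+) y y∈F
  Fφ-up-to-0 (suc m) y y∈F = Fφ-up-to-0 m y (weight -[1+ suc m ] (inj₁ ℤ.-<+) y y∈F)

  Fφ-up-above-p : ∀ m b y → p < b → FilXφk N (+ b) y → FilXφk N (+ (m ℕ.+ b)) y
  Fφ-up-above-p zero    b y p<b y∈F = y∈F
  Fφ-up-above-p (suc m) b y p<b y∈F = weight (+ (m ℕ.+ b)) (inj₂ (ℤ.+<+ (ℕP.<-≤-trans p<b (ℕP.m≤n+m b m))))
                                         y (Fφ-up-above-p m b y p<b y∈F)

  lift-to-F⁰ : ∀ d t → FilXk N -[1+ d ] t →
    ∃ λ y → ∃ λ w → (app mat (frobV y) ≈V shV den w) × (∀ l → t l 0 ≈ y l 0)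
  lift-to-F⁰ d t t∈F with x , (s′ , w , φy∈N) , (s , φx≡φt) ← onto (+ 0) (frobV t) (Fφ-up-to-0 d (frobV t) (into -[1+ d ] t t∈F))
    = x +V shV 1 s′ , w , ≈V-trans (≈V-sym (shV-zero _)) (≈V-trans φy∈N (shV-cong den (shV-zero w)))
    , λ l → trans (same-constant l) (sym (+-identityʳ _))
    where
      same-constant : ∀ l → t l 0 ≈ x l 0
      same-constant l = frobenius-injective l (trans (sym (frobS-constant (t l)))
        (trans (sym (≡u⇒constant s φx≡φt l)) (frobS-constant (x l))))

  φ-bounded : ℕ → Set _
  φ-bounded d = ∀ t → ∃ λ w → shV d (app mat (frobV t)) ≈V shV den w

  -- if t = y + u r with φ(y) ∈ N and φ(N) ⊆ u^{-(d+1)} N, then φ(t) ∈ u^{-d} N,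
  -- since φ(u r) = uᵖ φ(r) and p ≥ 1
  φ-bounded-congruent : ∀ d → φ-bounded (suc d) → ∀ t y r w →
    t ≈V (y +V shV 1 r) → app mat (frobV y) ≈V shV den w →
    ∃ λ w″ → shV d (app mat (frobV t)) ≈V shV den w″
  φ-bounded-congruent d bounded t y r w t≡y φy∈N
    with w′ , φr∈N ← bounded r
    = shV d w +V shV q w′ , (begin
      shV d (app mat (frobV t))                                ≈⟨ shV-cong d (app-cong mat (frobV-cong t≡y)) ⟩
      shV d (app mat (frobV (y +V shV 1 r)))                   ≈⟨ shV-cong d (app-frobV-split mat y r) ⟩
      shV d (app mat (frobV y) +V shV p (app mat (frobV r)))  ≈⟨ shV-+ d _ _ ⟩
      shV d (app mat (frobV y)) +V shV d (shV p (app mat (frobV r)))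
        ≈⟨ +V-cong (≈V-trans (shV-cong d φy∈N) (shV-comm d den w)) (shift (app mat (frobV r))) ⟩
      shV den (shV d w) +V shV q (shV (suc d) (app mat (frobV r)))
        ≈⟨ +V-cong ≈V-refl (≈V-trans (shV-cong q φr∈N) (shV-comm q den w′)) ⟩
      shV den (shV d w) +V shV den (shV q w′)                  ≈⟨ shV-+ den _ _ ⟨
      shV den (shV d w +V shV q w′)                            ∎)
    where
      open SetoidReasoning (V-setoid rank)
      shift : ∀ v → shV d (shV p v) ≈V shV q (shV (suc d) v)
      shift v = ≈V-trans (shV-add d p v) (≈V-trans
        (≈V-reflexive (≡.cong (λ m → shV m v) (≡.trans (ℕP.+-comm d p) (≡.sym (ℕP.+-suc q d)))))
        (≈V-sym (shV-add q (suc d) v)))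

  φ-bounded⇒F : ∀ d → φ-bounded (suc d) → ∀ t → FilXk N -[1+ d ] t
  φ-bounded⇒F d bounded t = 0V , bounded (t +V shV 1 0V)

  φ-bounded-step : ∀ d → φ-bounded (suc d) → φ-bounded d
  φ-bounded-step d bounded t =
    let y , w , φy∈N , t≡y = lift-to-F⁰ d t (φ-bounded⇒F d bounded t)
    in φ-bounded-congruent d bounded t y (diff/u t y) w (constant⇒≡u t≡y) φy∈N

  φ-bounded-descend : ∀ d → φ-bounded d → φ-bounded 0
  φ-bounded-descend zero    bounded = bounded
  φ-bounded-descend (suc d) bounded = φ-bounded-descend d (φ-bounded-step d bounded)

  -- φ_N(N) ⊆ N, by descending induction from the trivial bound φ(N) ⊆ u^{-den} N
  φ-integral : ∀ t → ∃ λ w → app mat (frobV t) ≈V shV den w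
  φ-integral t =
    let w , e = φ-bounded-descend den (λ t → app mat (frobV t) , ≈V-refl) t
    in w , ≈V-trans (≈V-sym (shV-zero _)) e

  B : Mat rank rank
  B = proj₁ linIso

  eB : ℕ
  eB = proj₁ (proj₂ linIso)

  mat-divides : ∀ c z w → app mat z ≈V shV den (shV (eB ℕ.+ c) w) → z ≈V shV (den ℕ.+ c) (app B w)
  mat-divides c z w mat-z≈ = shV-inj eB (begin
    shV eB z                               ≈⟨ app-uId eB z ⟨
    app (uId eB) z                         ≈⟨ app-congˡ z (proj₂ (proj₂ (proj₂ linIso))) ⟨
    app (B ·M mat) z                       ≈⟨ app-·M B mat z ⟨
    app B (app mat z)                      ≈⟨ app-cong B mat-z≈ ⟩
    app B (shV den (shV (eB ℕ.+ c) w))     ≈⟨ ≈V-trans (app-sh B den (shV (eB ℕ.+ c) w)) (shV-cong den (app-sh B (eB ℕ.+ c) w)) ⟩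
    shV den (shV (eB ℕ.+ c) (app B w))     ≈⟨ shV-add den _ _ ⟩
    shV (den ℕ.+ (eB ℕ.+ c)) (app B w)     ≡⟨ ≡.cong (λ m → shV m (app B w)) (reorder den eB c) ⟩
    shV (eB ℕ.+ (den ℕ.+ c)) (app B w)     ≈⟨ shV-add eB _ _ ⟨
    shV eB (shV (den ℕ.+ c) (app B w))     ∎)
    where
      open SetoidReasoning (V-setoid rank)
      reorder : ∀ a b c → a ℕ.+ (b ℕ.+ c) ≡ b ℕ.+ (a ℕ.+ c)
      reorder a b c = ≡.trans (≡.sym (ℕP.+-assoc a b c)) (≡.trans (≡.cong (ℕ._+ c) (ℕP.+-comm a b)) (ℕP.+-assoc b a c))

  Fφ-high-vanishes : ∀ b y → FilXφk N (+ (eB ℕ.+ suc b)) y → ∀ l → y l 0 ≈ 0#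
  Fφ-high-vanishes b y (t , w , ι[y+ut]≈uᴶw) l = begin
      y l 0                              ≈⟨ ≡u⇒constant t (≈V-refl {x = y +V shV 1 t}) l ⟨
      (y +V shV 1 t) l 0                 ≈⟨ mat-divides (suc b) (y +V shV 1 t) w (≈V-trans (≈V-sym (shV-zero _)) ι[y+ut]≈uᴶw) l 0 ⟩
      sh (den ℕ.+ suc b) (app B w l) 0   ≡⟨ sh-lt (den ℕ.+ suc b) _ 0 (≡.subst (0 <_) (≡.sym (ℕP.+-suc den b)) (s≤s z≤n)) ⟩
      0#                                 ∎
    where open SetoidReasoning setoid

  F-vanishes-above-p : ∀ a → p < a → ∀ x → FilXk N (+ a) x → ∀ l → x l 0 ≈ 0#
  F-vanishes-above-p (suc a) p<a x x∈F l = frobenius-injective l (trans (sym (frobS-constant (x l)))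
      (trans (Fφ-high-vanishes a (frobV x) (Fφ-up-above-p eB (suc a) (frobV x) p<a (into (+ suc a) x x∈F)) l)
             (sym (zeroˡ _))))

module Lifting {c ℓ} (K : CommutativeRing c ℓ) (q : ℕ) (field-k : BK.IsFiniteFieldOfChar K (suc q))
    {M N P : BK.Obj K (suc q)} (f : BK.Hom K (suc q) M N) (g : BK.Hom K (suc q) N P)
    (exact : BK.ShortExact K (suc q) f g) (sd : BK.StronglyDivisible K (suc q) N) where
  open BK K (suc q)
  open IsFiniteFieldOfChar field-k
  open Series K (suc q)
  open FrobeniusSeries K q
  open Additive (Frobenius.frobenius-+ K q prime char)
  open Laurent K (suc q)
  open Morphisms K q
  open Saturation f g exact
  open StronglyDivisibleFacts K q field-k N sd
  open Obj M using () renaming (den to dM; mat to AM)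
  open Obj N using () renaming (den to dN; mat to AN)

  -- For i ≤ p, f(x) ∈ F^i N_k already gives x ∈ F^i M_k: in
  -- φ(f x + u t) = φ(f x) + uᵖ φ(t) the last term lies in uᵖN ⊆ uⁱN since
  -- φ(N) ⊆ N, so f(φ x) = φ(f x) ∈ uⁱN, and saturation gives φ(x) ∈ uⁱM.
  lift-low : ∀ i → i ℤ.≤ + p → ∀ x → FilXk N i (apply f x) → FilXk M i x
  lift-low i i≤p x (t , φ[fx+ut]∈uⁱ) =
    0V , InUX-resp i (φX M (x +V shV 1 0V)) (φX M x) (φX-cong M (≈V-sym (≡u-refl x))) φx∈uⁱ
    where
      fx : V (Obj.rank N)
      fx = app F x
      w₀ : V (Obj.rank N)
      w₀ = proj₁ (φ-integral t)
      split : (dN , (app AN (frobV fx) +V shV p (shV dN w₀))) ~ φX N (fx +V shV 1 t)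
      split = ~-same-den dN (≈V-sym (≈V-trans (app-frobV-split AN fx t)
                                      (+V-cong ≈V-refl (shV-cong p (proj₂ (φ-integral t))))))
      φfx∈uⁱ : InUX i (φX N fx)
      φfx∈uⁱ = InUX-drop i p i≤p dN (app AN (frobV fx)) w₀
                 (InUX-resp i (dN , (app AN (frobV fx) +V shV p (shV dN w₀))) (φX N (fx +V shV 1 t)) split φ[fx+ut]∈uⁱ)
      φx∈uⁱ : InUX i (φX M x)
      φx∈uⁱ = saturated i dM (app AM (frobV x))
                (InUX-resp i (dM , app F (app AM (frobV x))) (φX N fx) (~-sym (φX N fx) (dM , app F (app AM (frobV x))) (Hom.comm f x)) φfx∈uⁱ)

  -- For a > p, F^a N_k = 0, so f(x) ≡ f(0) mod u and 0 ∈ F^a M_k.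
  lift-high : ∀ a → p < a → ∀ x → FilXk N (+ a) (apply f x) →
    FilXk M (+ a) 0V × _≡u_ N (apply f 0V) (apply f x)
  lift-high a p<a x fx∈F =
      (0V , InUX-0 (+ a) dM φ0≈0)
    , (_ , constant⇒≡u (λ l → trans (app-0 F l 0) (sym (F-vanishes-above-p a p<a (app F x) fx∈F l))))
    where
      open CommutativeRing K using (trans; sym)
      φ0≈0 : app AM (frobV (0V +V shV 1 0V)) ≈V 0V
      φ0≈0 = ≈V-trans (app-cong AM (≈V-trans (frobV-cong (≈V-sym (≡u-refl 0V))) frobV-0)) (app-0 AM)

lemma5p25 : ∀ {c ℓ} (K : CommutativeRing c ℓ) (p : ℕ) →
    let open BK K p in
    IsFiniteFieldOfChar →
    (M N P : Obj) (f : Hom M N) (g : Hom N P) →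
    ShortExact f g → StronglyDivisible N → StrictReduction f
-- p is prime, hence p = q + 1; then split according to the level i ≤ p or i > p
lemma5p25 K zero    field-k M N P f g exact sd = ⊥-elim (¬prime[0] (BK.IsFiniteFieldOfChar.prime field-k))
lemma5p25 K (suc q) field-k M N P f g exact sd i = Morphisms.Hom-filtered K q f i , lift i
  where
    open BK K (suc q)
    open Series K (suc q) using (≡u-refl)
    open Lifting K q field-k f g exact sd
    lift : ∀ i x → FilXk N i (apply f x) → ∃ λ x′ → FilXk M i x′ × _≡u_ N (apply f x′) (apply f x)
    lift -[1+ j ] x fx∈F = x , lift-low -[1+ j ] ℤ.-≤+ x fx∈F , (0V , ≡u-refl (apply f x))
    lift (+ a) x fx∈F with a ℕP.≤? suc q
    ... | yes a≤p = x , lift-low (+ a) (ℤ.+≤+ a≤p) x fx∈F , (0V , ≡u-refl (apply f x))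
    ... | no a≰p  = 0V , lift-high a (ℕP.≰⇒> a≰p) x fx∈F
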